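{- Let $n\ge 1$ and let ${\cal OCT}_n$ be the set of order-preserving full contractions of $X_n=\{1,\dots,n\}$. For integers $p,m,k$ with $n\ge k\ge p\ge m\ge 1$, let $F(n;p,m,k)$ denote the number of $\alpha\in{\cal OCT}_n$ with $h(\alpha)=p$, $f(\alpha)=m$ and $w^+(\alpha)=k$. Then $$F(n;p,m,k)=\binom{n-m-1}{n-p-1}.$$
   Context: $X_n=\{1,2,\dots,n\}$ with its usual order. A full transformation of $X_n$ is a map $\alpha:X_n\to X_n$; the image of $x$ is written $x\alpha$. $\alpha$ is order-preserving if $x\le y\Rightarrow x\alpha\le y\alpha$, and a contraction if $|x\alpha-y\alpha|\le |x-y|$ for all $x,y\in X_n$. For $\alpha$: the height is $h(\alpha)=|\mathrm{Im}\,\alpha|$, the right waist is $w^+(\alpha)=\max(\mathrm{Im}\,\alpha)$, $F(\alpha)=\{x\in X_n: x\alpha=x\}$ and the fix is $f(\alpha)=|F(\alpha)|$. Binomial coefficients $\binom{a}{b}$ with $a\ge -1$ are interpreted as $0$ if $b<0$ or $b>a$, except that $\binom{ -1}{ -1}=1$ (this matters only when $p=m=k=n$). -}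

module Defs where

open import Data.Nat using (ℕ; zero; suc; _≤_; _≤?_; ∣_-_∣)
open import Data.Nat.Combinatorics using (_C_)
open import Data.Integer using (ℤ; +_; -[1+_])
open import Data.Fin using (Fin; toℕ; _≟_)
open import Data.Fin.Properties using (all?; any?)
open import Data.Vec using (Vec; []; _∷_; lookup)
open import Data.List using (List; []; _∷_; [_]; map; concatMap; filter; length; allFin)
open import Data.Product using (_×_; ∃)
open import Relation.Nullary using (Dec)
open import Relation.Nullary.Decidable using (_×-dec_; _→-dec_)
open import Relation.Binary.PropositionalEquality using (_≡_)
open import Data.Nat.Properties as ℕP using ()

-- A full transformation α of X_n = {1,…,n} is represented by the vector of
-- its images (α listed as 1α, …, nα); X_n is modelled by Fin n, where the
-- element i ∈ X_n corresponds to the index (i - 1) : Fin n.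
Transformation : ℕ → Set
Transformation n = Vec (Fin n) n

_·_ : ∀ {n} → Fin n → Transformation n → Fin n
x · α = lookup α x

allVecs : (m n : ℕ) → List (Vec (Fin n) m)
allVecs zero    n = [ [] ]
allVecs (suc m) n = concatMap (λ x → map (x ∷_) (allVecs m n)) (allFin n)

allTransformations : (n : ℕ) → List (Transformation n)
allTransformations n = allVecs n n

OrderPreserving : ∀ {n} → Transformation n → Set
OrderPreserving {n} α = (x y : Fin n) → toℕ x ≤ toℕ y → toℕ (x · α) ≤ toℕ (y · α)

Contraction : ∀ {n} → Transformation n → Set
Contraction {n} α = (x y : Fin n) → ∣ toℕ (x · α) - toℕ (y · α) ∣ ≤ ∣ toℕ x - toℕ y ∣

IsOCT : ∀ {n} → Transformation n → Set
IsOCT α = OrderPreserving α × Contraction α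

countFin : ∀ {n} {P : Fin n → Set} → ((x : Fin n) → Dec (P x)) → ℕ
countFin {n} P? = length (filter P? (allFin n))

height : ∀ {n} → Transformation n → ℕ
height {n} α = countFin {P = λ y → ∃ λ x → x · α ≡ y} (λ y → any? (λ x → (x · α) ≟ y))

fix : ∀ {n} → Transformation n → ℕ
fix α = countFin (λ x → (x · α) ≟ x)

-- w⁺(α) = k : k = max Im α (k read in X_n = {1,…,n}, i.e. index + 1)
RightWaistIs : ∀ {n} → Transformation n → ℕ → Set
RightWaistIs {n} α k =
  (∃ λ x → suc (toℕ (x · α)) ≡ k) × ((x : Fin n) → suc (toℕ (x · α)) ≤ k)

isOCT? : ∀ {n} (α : Transformation n) → Dec (IsOCT α)
isOCT? α =
  all? (λ x → all? (λ y → (toℕ x ≤? toℕ y) →-dec (toℕ (x · α) ≤? toℕ (y · α))))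
  ×-dec all? (λ x → all? (λ y → ∣ toℕ (x · α) - toℕ (y · α) ∣ ≤? ∣ toℕ x - toℕ y ∣))

rightWaistIs? : ∀ {n} (α : Transformation n) (k : ℕ) → Dec (RightWaistIs α k)
rightWaistIs? α k =
  any? (λ x → suc (toℕ (x · α)) ℕP.≟ k) ×-dec all? (λ x → suc (toℕ (x · α)) ≤? k)

Counted : ∀ {n} → ℕ → ℕ → ℕ → Transformation n → Set
Counted p m k α = IsOCT α × (height α ≡ p) × (fix α ≡ m) × RightWaistIs α k

counted? : ∀ {n} (p m k : ℕ) (α : Transformation n) → Dec (Counted p m k α)
counted? p m k α =
  isOCT? α ×-dec (height α ℕP.≟ p) ×-dec (fix α ℕP.≟ m) ×-dec rightWaistIs? α k

F : ℕ → ℕ → ℕ → ℕ → ℕ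
F n p m k = length (filter (counted? {n} p m k) (allTransformations n))

-- binomial coefficient with integer arguments (a ≥ -1 in use):
-- 0 if b < 0 or b > a, except binom(-1,-1) = 1; otherwise a choose b.
binomℤ : ℤ → ℤ → ℕ
binomℤ -[1+ 0 ] -[1+ 0 ] = 1
binomℤ (+ a)    (+ b)    = a C b
binomℤ _        _        = 0

module Submission where

-- An order-preserving full contraction α of X_n is a "step chain": each value
-- is the previous one or the previous one plus 1 (`oct⇒chain`,
-- `chain⇒orderPreserving`, `chain⇒contraction`).  Along a chain the image is the
-- whole interval between the first and the last value, so h(α) = last − first + 1
-- and w⁺(α) = last + 1 (`height-chain`, `waist-chain`), while the fixed points are
-- counted position by position (`fix-fixesFrom`).  Prescribing h = p and w⁺ = k
-- therefore fixes the first value (k − p) and the last value (k − 1), and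
-- F(n;p,m,k) becomes the number of step sequences with these end points meeting
-- the diagonal exactly m times.
-- Since i ↦ iα − i never increases, the diagonal is met in one block; this lets
-- `chains` be evaluated by the Pascal rule, separately for a start on the diagonal
-- (`chains-fixedStart-closed`) and above it (`chains-raisedStart-closed`), and
-- both cases give C(n − m − 1, n − p − 1) (`chains-count`, `paper-binomial`).

open import Defs
open import Data.Nat
open import Data.Nat.Properties
open import Data.Nat.Combinatorics using (_C_; nCn≡1; nCk≡nC[n∸k]; nCk+nC[k+1]≡[n+1]C[k+1]; k>n⇒nCk≡0)
open import Data.Integer using (+_; _-_)
import Data.Integer.Properties as ℤ
open import Data.Bool using (Bool; true; false; if_then_else_; _∧_; _∨_; T)
open import Data.Bool.Properties using (∧-zeroʳ; ∧-assoc; T-∧; T-∨)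
open import Data.Unit using (tt)
open import Data.Empty using (⊥-elim)
open import Data.Fin using (Fin; zero; suc; toℕ)
import Data.Fin as Fin
open import Data.Fin.Properties using (toℕ<n; toℕ-injective; any?)
open import Data.Vec using (Vec; []; _∷_; lookup)
open import Data.List using (List; []; _∷_; _++_; map; concatMap; filter; length; tabulate; allFin)
open import Data.Product using (_×_; _,_; proj₁; proj₂; ∃)
open import Data.Sum using (inj₁; inj₂)
open import Function.Bundles using (_⇔_; mk⇔; Equivalence)
open import Relation.Binary.PropositionalEquality
open import Relation.Nullary using (yes; no; does)
open import Relation.Nullary.Decidable using (dec-true; dec-false; does-⇔; T?)
open import Relation.Unary using (Decidable)

indicator : Bool → ℕ
indicator b = if b then 1 else 0

≡ᵇ-refl : ∀ n → (n ≡ᵇ n) ≡ true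
≡ᵇ-refl n = dec-true (n ≟ n) refl

≢⇒≡ᵇ-false : ∀ {m n} → m ≢ n → (m ≡ᵇ n) ≡ false
≢⇒≡ᵇ-false {m} {n} m≢n = dec-false (m ≟ n) m≢n

<⇒≡ᵇ-false : ∀ {m n} → m < n → (m ≡ᵇ n) ≡ false
<⇒≡ᵇ-false m<n = ≢⇒≡ᵇ-false (<⇒≢ m<n)

-- `spendFix z b g f` continues with `g` when the current position is not a fixed
-- point (b = false); a fixed point uses up one of the f fixed points still
-- required, and there is no continuation (value z) if none is left.
spendFix : {A : Set} → A → Bool → (ℕ → A) → ℕ → A
spendFix z false g f       = g f
spendFix z true  g zero    = z
spendFix z true  g (suc f) = g f

spendFix-cong : ∀ {A : Set} (z : A) b {g h : ℕ → A} → (∀ f → g f ≡ h f) →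
                ∀ f → spendFix z b g f ≡ spendFix z b h f
spendFix-cong z false g≗h f       = g≗h f
spendFix-cong z true  g≗h zero    = refl
spendFix-cong z true  g≗h (suc f) = g≗h f

spendFix-zero : ∀ b {g : ℕ → ℕ} → (∀ f → g f ≡ 0) → ∀ f → spendFix 0 b g f ≡ 0
spendFix-zero false g≗0 f       = g≗0 f
spendFix-zero true  g≗0 zero    = refl
spendFix-zero true  g≗0 (suc f) = g≗0 f

spendFix-vanishes : ∀ x j {g : ℕ → ℕ} f → (x ≡ j → ∀ f′ → f ≡ suc f′ → g f′ ≡ 0) → (x ≢ j → g f ≡ 0) →
                    spendFix 0 (x ≡ᵇ j) g f ≡ 0
spendFix-vanishes x j f visit skip with x ≡ᵇ j in eq
... | false = skip (λ x≡j → subst T eq (≡⇒≡ᵇ x j x≡j))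
spendFix-vanishes x j zero    visit skip | true = refl
spendFix-vanishes x j (suc f) visit skip | true = visit (≡ᵇ⇒≡ x j (subst T (sym eq) tt)) f refl

-- `chains m j a e f` counts the sequences y₁,…,y_m with y_{i+1} ∈ {y_i, y_i + 1}
-- (where y₀ = a), ending at e (y_m = e, or a = e if m = 0), and having exactly f
-- fixed points, y_i sitting at position j + i − 1.  So a is the value at the
-- current position j − 1, whose fixedness has already been accounted for.
chains : ℕ → ℕ → ℕ → ℕ → ℕ → ℕ
chains zero    j a e f = indicator ((a ≡ᵇ e) ∧ (f ≡ᵇ 0))
chains (suc m) j a e f =
  spendFix 0 (a ≡ᵇ j) (chains m (suc j) a e) f + spendFix 0 (suc a ≡ᵇ j) (chains m (suc j) (suc a) e) f

chains-shift : ∀ m j a e f → chains m (suc j) (suc a) (suc e) f ≡ chains m j a e f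
chains-shift zero    j a e f = refl
chains-shift (suc m) j a e f =
  cong₂ _+_ (spendFix-cong 0 (a ≡ᵇ j) (chains-shift m (suc j) a e) f)
            (spendFix-cong 0 (suc a ≡ᵇ j) (chains-shift m (suc j) (suc a) e) f)

-- Values never decrease, so an end value below the current one is unreachable.
chains-overshoot : ∀ m j a e f → e < a → chains m j a e f ≡ 0
chains-overshoot zero    j a e f e<a rewrite ≢⇒≡ᵇ-false (>⇒≢ e<a) = refl
chains-overshoot (suc m) j a e f e<a =
  cong₂ _+_ (spendFix-zero (a ≡ᵇ j) (λ f → chains-overshoot m (suc j) a e f e<a) f)
            (spendFix-zero (suc a ≡ᵇ j) (λ f → chains-overshoot m (suc j) (suc a) e f (m<n⇒m<1+n e<a)) f)

-- Below the diagonal (value < position) a chain never meets it again ...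
chains-below-fixed : ∀ m j a e f → suc a < j → chains m j a e (suc f) ≡ 0
chains-below-fixed zero    j a e f _ = cong indicator (∧-zeroʳ (a ≡ᵇ e))
chains-below-fixed (suc m) j a e f a+1<j
  rewrite <⇒≡ᵇ-false (<-trans (n<1+n a) a+1<j) | <⇒≡ᵇ-false a+1<j =
  cong₂ _+_ (chains-below-fixed m (suc j) a e f (m<n⇒m<1+n a+1<j))
            (chains-below-fixed m (suc j) (suc a) e f (s≤s a+1<j))

-- ... so there the u unit steps among m steps are placed freely.
chains-below : ∀ m j a u → suc a < j → chains m j a (a + u) 0 ≡ m C u
chains-below zero j a zero    _ rewrite +-identityʳ a | ≡ᵇ-refl a = refl
chains-below zero j a (suc u) _ rewrite ≢⇒≡ᵇ-false (λ eq → m≢1+m+n a (trans eq (+-suc a u))) = refl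
chains-below (suc m) j a u a+1<j
  rewrite <⇒≡ᵇ-false (<-trans (n<1+n a) a+1<j) | <⇒≡ᵇ-false a+1<j
  with u
... | zero  = cong₂ _+_ (chains-below m (suc j) a 0 (m<n⇒m<1+n a+1<j))
                         (chains-overshoot m (suc j) (suc a) (a + 0) 0 (s≤s (≤-reflexive (+-identityʳ a))))
... | suc u =
  begin
    chains m (suc j) a (a + suc u) 0 + chains m (suc j) (suc a) (a + suc u) 0
  ≡⟨ cong₂ _+_ (chains-below m (suc j) a (suc u) (m<n⇒m<1+n a+1<j))
               (trans (cong (λ e → chains m (suc j) (suc a) e 0) (+-suc a u))
                      (chains-below m (suc j) (suc a) u (s≤s a+1<j))) ⟩
    m C suc u + m C u
  ≡⟨ +-comm (m C suc u) (m C u) ⟩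
    m C u + m C suc u
  ≡⟨ nCk+nC[k+1]≡[n+1]C[k+1] m u ⟩
    suc m C suc u
  ∎
  where open ≡-Reasoning

-- Once on or below the diagonal, every further fixed point needs a unit step:
-- more fixed points than the remaining e − a unit steps are impossible.
chains-fixes-beyond-ones : ∀ m j a e f → a < j → suc e ≤ a + f → chains m j a e f ≡ 0
chains-fixes-beyond-ones zero j a e zero    _ e<a =
  cong (λ b → indicator (b ∧ true)) (≢⇒≡ᵇ-false (>⇒≢ (≤-trans e<a (≤-reflexive (+-identityʳ a)))))
chains-fixes-beyond-ones zero j a e (suc f) _ _   = cong indicator (∧-zeroʳ (a ≡ᵇ e))
chains-fixes-beyond-ones (suc m) j a e f a<j bound =
  cong₂ _+_
    (spendFix-vanishes a j f (λ a≡j → ⊥-elim (<⇒≢ a<j a≡j))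
       (λ _ → chains-fixes-beyond-ones m (suc j) a e f (m<n⇒m<1+n a<j) bound))
    (spendFix-vanishes (suc a) j f
       (λ { refl f′ refl → chains-fixes-beyond-ones m (suc (suc a)) (suc a) e f′ (n<1+n (suc a))
                             (subst (suc e ≤_) (+-suc a f′) bound) })
       (λ _ → chains-fixes-beyond-ones m (suc j) (suc a) e f (s≤s a<j) (≤-trans bound (n≤1+n _))))

chains-fixes-beyond-ones+1 : ∀ m j a e f → suc (suc e) ≤ a + f → chains m j a e f ≡ 0
chains-fixes-beyond-ones+1 zero j a e zero    e+1<a =
  cong (λ b → indicator (b ∧ true))
       (≢⇒≡ᵇ-false (>⇒≢ (≤-trans (n≤1+n _) (≤-trans e+1<a (≤-reflexive (+-identityʳ a))))))
chains-fixes-beyond-ones+1 zero j a e (suc f) _ = cong indicator (∧-zeroʳ (a ≡ᵇ e))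
chains-fixes-beyond-ones+1 (suc m) j a e f bound =
  cong₂ _+_
    (spendFix-vanishes a j f
       (λ { refl f′ refl → chains-fixes-beyond-ones m (suc a) a e f′ (n<1+n a)
                             (s≤s⁻¹ (subst (suc (suc e) ≤_) (+-suc a f′) bound)) })
       (λ _ → chains-fixes-beyond-ones+1 m (suc j) a e f bound))
    (spendFix-vanishes (suc a) j f
       (λ { refl f′ refl → chains-fixes-beyond-ones m (suc (suc a)) (suc a) e f′ (n<1+n (suc a))
                             (≤-trans (s≤s⁻¹ (subst (suc (suc e) ≤_) (+-suc a f′) bound)) (n≤1+n _)) })
       (λ _ → chains-fixes-beyond-ones+1 m (suc j) (suc a) e f (≤-trans bound (n≤1+n _))))

-- C(x − 1, y − 1) for natural x, y, with the convention C(−1, −1) = 1.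
shiftedBinom : ℕ → ℕ → ℕ
shiftedBinom zero    zero    = 1
shiftedBinom zero    (suc y) = 0
shiftedBinom (suc x) zero    = 0
shiftedBinom (suc x) (suc y) = x C y

binomℤ-shifted : ∀ x y → binomℤ (+ x - + 1) (+ y - + 1) ≡ shiftedBinom x y
binomℤ-shifted zero    zero    = refl
binomℤ-shifted zero    (suc y) = refl
binomℤ-shifted (suc x) zero    = refl
binomℤ-shifted (suc x) (suc y) = refl

shiftedBinom-diag : ∀ y → shiftedBinom y y ≡ y C y
shiftedBinom-diag zero    = refl
shiftedBinom-diag (suc y) = trans (nCn≡1 y) (sym (nCn≡1 (suc y)))

shiftedBinom-pascal : ∀ x y → shiftedBinom (suc x) y + x C y ≡ suc x C y
shiftedBinom-pascal x zero    = refl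
shiftedBinom-pascal x (suc y) = nCk+nC[k+1]≡[n+1]C[k+1] x y

C-symmetric : ∀ a b → (a + b) C a ≡ (a + b) C b
C-symmetric a b = trans (nCk≡nC[n∸k] (m≤m+n a b)) (cong (λ k → (a + b) C k) (m+n∸m≡n a b))

-- Starting on the diagonal (value 0 at position 0), the f further fixed points
-- must come from the next f steps, all of them unit steps.
chains-fixedStart-unroll : ∀ f M u → chains (f + M) 1 0 (f + u) f ≡ chains M 1 0 u 0
chains-fixedStart-unroll zero    M u = refl
chains-fixedStart-unroll (suc f) M u =
  begin
    chains (f + M) 2 0 (suc (f + u)) (suc f) + chains (f + M) 2 1 (suc (f + u)) f
  ≡⟨ cong₂ _+_ (chains-below-fixed (f + M) 2 0 _ f (s≤s (s≤s z≤n))) (chains-shift (f + M) 1 0 (f + u) f) ⟩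
    chains (f + M) 1 0 (f + u) f
  ≡⟨ chains-fixedStart-unroll f M u ⟩
    chains M 1 0 u 0
  ∎
  where open ≡-Reasoning

-- With no fixed point left, the chain leaves the diagonal by a flat step.
chains-fixedStart-free : ∀ m u → chains (suc m) 1 0 u 0 ≡ m C u
chains-fixedStart-free m u = trans (+-identityʳ _) (chains-below m 2 0 u (s≤s (s≤s z≤n)))

-- Start on the diagonal: u + f unit steps, D flat steps, f more fixed points.
chains-fixedStart-closed : ∀ f u D → chains (f + (u + D)) 1 0 (f + u) f ≡ shiftedBinom (u + D) D
chains-fixedStart-closed f u D = trans (chains-fixedStart-unroll f (u + D) u) (free u D)
  where
  free : ∀ u D → chains (u + D) 1 0 u 0 ≡ shiftedBinom (u + D) D
  free zero    zero    = refl
  free (suc u) zero    = trans (chains-fixedStart-free (u + 0) (suc u)) (k>n⇒nCk≡0 (s≤s (≤-reflexive (+-identityʳ u))))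
  free u       (suc D) rewrite +-suc u D = trans (chains-fixedStart-free (u + D) u) (C-symmetric u D)

-- First step from above the diagonal: a flat step brings the chain one level
-- closer to the diagonal (reaching it from level 1), a unit step keeps the level.
chains-descend-to-diagonal : ∀ m e f →
  chains (suc m) 1 1 (suc e) (suc f) ≡ chains m 1 0 e f + chains m 1 1 e (suc f)
chains-descend-to-diagonal m e f = cong₂ _+_ (chains-shift m 1 0 e f) (chains-shift m 1 1 e (suc f))

chains-descend : ∀ m d e f →
  chains (suc m) 1 (suc (suc d)) (suc e) f ≡ chains m 1 (suc d) e f + chains m 1 (suc (suc d)) e f
chains-descend m d e f = cong₂ _+_ (chains-shift m 1 (suc d) e f) (chains-shift m 1 (suc (suc d)) e f)

+-suc-inner : ∀ f u D → f + (u + suc D) ≡ suc (f + (u + D))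
+-suc-inner f u D = trans (cong (λ x → f + x) (+-suc u D)) (+-suc f (u + D))

-- Start at level d + 1 above the diagonal with f + u unit steps and D + 1 flat
-- steps, requiring f + 1 fixed points; `chains-raisedStart-step` splits off the
-- first step (the block of fixed points is entered after d + 1 flat steps).
chains-raisedStart-closed : ∀ f u D d → d ≤ D →
  chains (f + (u + suc D)) 1 (suc d) (suc d + (f + u)) (suc f) ≡ (u + D) C D
chains-raisedStart-step : ∀ f u D d → d ≤ D →
  chains (f + (u + suc D)) 1 (suc d) (suc d + (f + u)) (suc f)
    ≡ shiftedBinom (u + D) D + chains (f + (u + D)) 1 (suc d) (d + (f + u)) (suc f)

chains-raisedStart-step f u D zero _ rewrite +-suc-inner f u D =
  trans (chains-descend-to-diagonal (f + (u + D)) (f + u) f)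
        (cong (_+ chains (f + (u + D)) 1 1 (f + u) (suc f)) (chains-fixedStart-closed f u D))
chains-raisedStart-step f u (suc D) (suc d) (s≤s d≤D) rewrite +-suc-inner f u (suc D) =
  trans (chains-descend (f + (u + suc D)) d (suc d + (f + u)) (suc f))
        (cong (_+ chains (f + (u + suc D)) 1 (suc (suc d)) (suc d + (f + u)) (suc f))
              (trans (chains-raisedStart-closed f u D d d≤D)
                     (cong (λ x → shiftedBinom x (suc D)) (sym (+-suc u D)))))

chains-raisedStart-closed f zero D d d≤D =
  begin
    chains (f + suc D) 1 (suc d) (suc d + (f + 0)) (suc f)
  ≡⟨ chains-raisedStart-step f 0 D d d≤D ⟩
    shiftedBinom D D + chains (f + D) 1 (suc d) (d + (f + 0)) (suc f)
  ≡⟨ cong (λ x → shiftedBinom D D + x) (chains-fixes-beyond-ones+1 (f + D) 1 (suc d) _ (suc f) (s≤s bound)) ⟩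
    shiftedBinom D D + 0
  ≡⟨ trans (+-identityʳ _) (shiftedBinom-diag D) ⟩
    D C D
  ∎
  where
  open ≡-Reasoning
  bound : suc (d + (f + 0)) ≤ d + suc f
  bound = ≤-reflexive (trans (cong (λ x → suc (d + x)) (+-identityʳ f)) (sym (+-suc d f)))
chains-raisedStart-closed f (suc u) D d d≤D =
  begin
    chains (f + (suc u + suc D)) 1 (suc d) (suc d + (f + suc u)) (suc f)
  ≡⟨ chains-raisedStart-step f (suc u) D d d≤D ⟩
    shiftedBinom (suc (u + D)) D + chains (f + (suc u + D)) 1 (suc d) (d + (f + suc u)) (suc f)
  ≡⟨ cong (λ x → shiftedBinom (suc (u + D)) D + x)
          (trans (cong₂ (λ m e → chains m 1 (suc d) e (suc f)) total last) (chains-raisedStart-closed f u D d d≤D)) ⟩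
    shiftedBinom (suc (u + D)) D + (u + D) C D
  ≡⟨ shiftedBinom-pascal (u + D) D ⟩
    suc (u + D) C D
  ∎
  where
  open ≡-Reasoning
  total : f + (suc u + D) ≡ f + (u + suc D)
  total = cong (λ x → f + x) (sym (+-suc u D))
  last : d + (f + suc u) ≡ suc d + (f + u)
  last = trans (cong (λ x → d + x) (+-suc f u)) (+-suc d (f + u))

-- The chains counted by F: m = f + 1 fixed points, height p = f + u + 1,
-- first value c (k = p + c) and n = k + r; the result is C(n − m − 1, n − p − 1).
chains-count : ∀ f u c r →
  spendFix 0 (c ≡ᵇ 0) (chains (f + u + c + r) 1 c (f + u + c)) (suc f) ≡ shiftedBinom (u + (c + r)) (c + r)
chains-count f u zero r =
  trans (cong₂ (λ M e → chains M 1 0 e f) total last) (chains-fixedStart-closed f u r)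
  where
  total : f + u + 0 + r ≡ f + (u + r)
  total = trans (cong (_+ r) (+-identityʳ (f + u))) (+-assoc f u r)
  last : f + u + 0 ≡ f + u
  last = +-identityʳ (f + u)
chains-count f u (suc d) r =
  trans (cong₂ (λ M e → chains M 1 (suc d) e (suc f)) total last)
        (trans (chains-raisedStart-closed f u (d + r) d (m≤m+n d r))
               (cong (λ x → shiftedBinom x (suc (d + r))) (sym (+-suc u (d + r)))))
  where
  total : f + u + suc d + r ≡ f + (u + suc (d + r))
  total = trans (+-assoc (f + u) (suc d) r) (+-assoc f u (suc (d + r)))
  last : f + u + suc d ≡ suc d + (f + u)
  last = +-comm (f + u) (suc d)

count : {A : Set} → (A → Bool) → List A → ℕ
count p []       = 0
count p (x ∷ xs) = indicator (p x) + count p xs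

length-filter : ∀ {A : Set} {P : A → Set} (P? : Decidable P) xs →
                length (filter P? xs) ≡ count (λ x → does (P? x)) xs
length-filter P? []       = refl
length-filter P? (x ∷ xs) with does (P? x)
... | true  = cong suc (length-filter P? xs)
... | false = length-filter P? xs

count-cong : ∀ {A : Set} {p q : A → Bool} → (∀ x → p x ≡ q x) → ∀ xs → count p xs ≡ count q xs
count-cong p≗q []       = refl
count-cong p≗q (x ∷ xs) = cong₂ _+_ (cong indicator (p≗q x)) (count-cong p≗q xs)

count-++ : ∀ {A : Set} (p : A → Bool) xs ys → count p (xs ++ ys) ≡ count p xs + count p ys
count-++ p []       ys = refl
count-++ p (x ∷ xs) ys =
  trans (cong (λ n → indicator (p x) + n) (count-++ p xs ys)) (sym (+-assoc (indicator (p x)) _ _))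

count-map : ∀ {A B : Set} (p : B → Bool) (g : A → B) xs → count p (map g xs) ≡ count (λ x → p (g x)) xs
count-map p g []       = refl
count-map p g (x ∷ xs) = cong (λ n → indicator (p (g x)) + n) (count-map p g xs)

count-false : ∀ {A : Set} (xs : List A) → count (λ _ → false) xs ≡ 0
count-false []       = refl
count-false (x ∷ xs) = count-false xs

count-∧ : ∀ {A : Set} b (q : A → Bool) xs → count (λ x → b ∧ q x) xs ≡ (if b then count q xs else 0)
count-∧ true  q xs = refl
count-∧ false q xs = count-false xs

count-spendFix : ∀ {A : Set} b (q : ℕ → A → Bool) f xs →
                 count (λ x → spendFix false b (λ f′ → q f′ x) f) xs ≡ spendFix 0 b (λ f′ → count (q f′) xs) f
count-spendFix false q f       xs = refl
count-spendFix true  q zero    xs = count-false xs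
count-spendFix true  q (suc f) xs = refl

sumFin : (n : ℕ) → (Fin n → ℕ) → ℕ
sumFin zero    g = 0
sumFin (suc n) g = g zero + sumFin n (λ i → g (suc i))

sumFin-cong : ∀ n {g h : Fin n → ℕ} → (∀ i → g i ≡ h i) → sumFin n g ≡ sumFin n h
sumFin-cong zero    g≗h = refl
sumFin-cong (suc n) g≗h = cong₂ _+_ (g≗h zero) (sumFin-cong n (λ i → g≗h (suc i)))

sumFin-zero : ∀ n → sumFin n (λ _ → 0) ≡ 0
sumFin-zero zero    = refl
sumFin-zero (suc n) = sumFin-zero n

count-tabulate : ∀ {A : Set} n (p : A → Bool) (g : Fin n → A) →
                 count p (tabulate g) ≡ sumFin n (λ i → indicator (p (g i)))
count-tabulate zero    p g = refl
count-tabulate (suc n) p g =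
  cong (λ s → indicator (p (g zero)) + s) (count-tabulate n p (λ i → g (suc i)))

count-concatMap : ∀ {A B : Set} n (p : B → Bool) (h : A → List B) (g : Fin n → A) →
                  count p (concatMap h (tabulate g)) ≡ sumFin n (λ i → count p (h (g i)))
count-concatMap zero    p h g = refl
count-concatMap (suc n) p h g =
  trans (count-++ p (h (g zero)) _)
        (cong (λ s → count p (h (g zero)) + s) (count-concatMap n p h (λ i → g (suc i))))

select-one : ∀ N c (G : ℕ → ℕ) → (∀ t → N ≤ t → G t ≡ 0) →
             sumFin N (λ i → if toℕ i ≡ᵇ c then G (toℕ i) else 0) ≡ G c
select-one zero    c       G vanish = sym (vanish c z≤n)
select-one (suc N) zero    G vanish = trans (cong (λ s → G 0 + s) (sumFin-zero N)) (+-identityʳ (G 0))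
select-one (suc N) (suc c) G vanish = select-one N c (λ t → G (suc t)) (λ t N≤t → vanish (suc t) (s≤s N≤t))

up-to : ∀ N L → L < N → sumFin N (λ i → indicator (toℕ i <ᵇ suc L)) ≡ suc L
up-to (suc N) zero    _         = cong suc (sumFin-zero N)
up-to (suc N) (suc L) (s≤s L<N) = cong suc (up-to N L L<N)

interval : ∀ N a L → a ≤ L → L < N →
           sumFin N (λ i → indicator ((a <ᵇ suc (toℕ i)) ∧ (toℕ i <ᵇ suc L))) ≡ suc L ∸ a
interval N       zero    L       _         L<N       = up-to N L L<N
interval (suc N) (suc a) (suc L) (s≤s a≤L) (s≤s L<N) = interval N a L a≤L L<N

step : ℕ → ℕ → Bool
step a t = (t ≡ᵇ a) ∨ (t ≡ᵇ suc a)

select-two : ∀ N a (G : ℕ → ℕ) → (∀ t → N ≤ t → G t ≡ 0) →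
             sumFin N (λ i → if step a (toℕ i) then G (toℕ i) else 0) ≡ G a + G (suc a)
select-two zero    a       G vanish = sym (cong₂ _+_ (vanish a z≤n) (vanish (suc a) z≤n))
select-two (suc N) zero    G vanish =
  cong (λ s → G 0 + s) (select-one N 0 (λ t → G (suc t)) (λ t N≤t → vanish (suc t) (s≤s N≤t)))
select-two (suc N) (suc a) G vanish = select-two N a (λ t → G (suc t)) (λ t N≤t → vanish (suc t) (s≤s N≤t))

module _ {N : ℕ} where

  chainFrom : ∀ {m} → ℕ → Vec (Fin N) m → Bool
  chainFrom a []      = true
  chainFrom a (y ∷ w) = step a (toℕ y) ∧ chainFrom (toℕ y) w

  lastFrom : ∀ {m} → ℕ → Vec (Fin N) m → ℕ
  lastFrom a []      = a
  lastFrom a (y ∷ w) = lastFrom (toℕ y) w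

  fixesFrom : ∀ {m} → ℕ → Vec (Fin N) m → ℕ
  fixesFrom j []      = 0
  fixesFrom j (y ∷ w) = indicator (toℕ y ≡ᵇ j) + fixesFrom (suc j) w

  -- the test whose count is `chains m j a e f`, by the same recursion
  good : ∀ {m} → ℕ → ℕ → ℕ → ℕ → Vec (Fin N) m → Bool
  good j a e f []      = (a ≡ᵇ e) ∧ (f ≡ᵇ 0)
  good j a e f (y ∷ w) = step a (toℕ y) ∧ spendFix false (toℕ y ≡ᵇ j) (λ f′ → good (suc j) (toℕ y) e f′ w) f

  startsAt : ∀ {m} → ℕ → ℕ → ℕ → Vec (Fin N) (suc m) → Bool
  startsAt c e f (x ∷ w) = (toℕ x ≡ᵇ c) ∧ spendFix false (toℕ x ≡ᵇ 0) (λ f′ → good 1 (toℕ x) e f′ w) f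

  spendFix-fixes : ∀ b c l X f →
                   spendFix false b (λ f′ → c ∧ (l ∧ (f′ ≡ᵇ X))) f ≡ c ∧ (l ∧ (f ≡ᵇ indicator b + X))
  spendFix-fixes false c l X f       = refl
  spendFix-fixes true  c l X zero    = sym (trans (cong (c ∧_) (∧-zeroʳ l)) (∧-zeroʳ c))
  spendFix-fixes true  c l X (suc f) = refl

  good-spec : ∀ {m} j a e f (w : Vec (Fin N) m) →
              good j a e f w ≡ chainFrom a w ∧ ((lastFrom a w ≡ᵇ e) ∧ (f ≡ᵇ fixesFrom j w))
  good-spec j a e f []      = refl
  good-spec j a e f (y ∷ w) =
    begin
      step a t ∧ spendFix false (t ≡ᵇ j) (λ f′ → good (suc j) t e f′ w) f
    ≡⟨ cong (step a t ∧_) (spendFix-cong false (t ≡ᵇ j) (λ f′ → good-spec (suc j) t e f′ w) f) ⟩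
      step a t ∧ spendFix false (t ≡ᵇ j) (λ f′ → chainFrom t w ∧ ((lastFrom t w ≡ᵇ e) ∧ (f′ ≡ᵇ fixesFrom (suc j) w))) f
    ≡⟨ cong (step a t ∧_) (spendFix-fixes (t ≡ᵇ j) (chainFrom t w) (lastFrom t w ≡ᵇ e) (fixesFrom (suc j) w) f) ⟩
      step a t ∧ (chainFrom t w ∧ ((lastFrom t w ≡ᵇ e) ∧ (f ≡ᵇ fixesFrom j (y ∷ w))))
    ≡⟨ sym (∧-assoc (step a t) (chainFrom t w) _) ⟩
      chainFrom a (y ∷ w) ∧ ((lastFrom a (y ∷ w) ≡ᵇ e) ∧ (f ≡ᵇ fixesFrom j (y ∷ w)))
    ∎
    where
    open ≡-Reasoning
    t = toℕ y

  startsAt-spec : ∀ {m} c e f (x : Fin N) (w : Vec (Fin N) m) →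
                  startsAt c e f (x ∷ w)
                    ≡ (toℕ x ≡ᵇ c) ∧ (chainFrom (toℕ x) w ∧ ((lastFrom (toℕ x) w ≡ᵇ e) ∧ (f ≡ᵇ fixesFrom 0 (x ∷ w))))
  startsAt-spec c e f x w =
    cong ((toℕ x ≡ᵇ c) ∧_)
      (trans (spendFix-cong false (toℕ x ≡ᵇ 0) (λ f′ → good-spec 1 (toℕ x) e f′ w) f)
             (spendFix-fixes (toℕ x ≡ᵇ 0) (chainFrom (toℕ x) w) (lastFrom (toℕ x) w ≡ᵇ e) (fixesFrom 1 w) f))

  -- Enumerating the first entry: only the values a and a + 1 pass the step test,
  -- and values ≥ N contribute nothing as the end value e is < N.
  count-good : ∀ m j a e f → e < N → count (good j a e f) (allVecs m N) ≡ chains m j a e f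
  count-good zero    j a e f e<N = +-identityʳ _
  count-good (suc m) j a e f e<N =
    begin
      count (good j a e f) (concatMap (λ y → map (y ∷_) (allVecs m N)) (tabulate (λ y → y)))
    ≡⟨ count-concatMap N (good j a e f) (λ y → map (y ∷_) (allVecs m N)) (λ y → y) ⟩
      sumFin N (λ i → count (good j a e f) (map (i ∷_) (allVecs m N)))
    ≡⟨ sumFin-cong N summand ⟩
      sumFin N (λ i → if step a (toℕ i) then G (toℕ i) else 0)
    ≡⟨ select-two N a G (λ t N≤t → spendFix-zero (t ≡ᵇ j)
                                     (λ f′ → chains-overshoot m (suc j) t e f′ (<-≤-trans e<N N≤t)) f) ⟩
      G a + G (suc a)
    ∎
    where
    open ≡-Reasoning
    G : ℕ → ℕ
    G t = spendFix 0 (t ≡ᵇ j) (chains m (suc j) t e) f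
    summand : ∀ i → count (good j a e f) (map (i ∷_) (allVecs m N)) ≡ (if step a (toℕ i) then G (toℕ i) else 0)
    summand i =
      begin
        count (good j a e f) (map (i ∷_) (allVecs m N))
      ≡⟨ count-map (good j a e f) (i ∷_) (allVecs m N) ⟩
        count (λ w → step a (toℕ i) ∧ spendFix false (toℕ i ≡ᵇ j) (λ f′ → good (suc j) (toℕ i) e f′ w) f) (allVecs m N)
      ≡⟨ count-∧ (step a (toℕ i)) _ (allVecs m N) ⟩
        (if step a (toℕ i)
         then count (λ w → spendFix false (toℕ i ≡ᵇ j) (λ f′ → good (suc j) (toℕ i) e f′ w) f) (allVecs m N)
         else 0)
      ≡⟨ cong (λ n → if step a (toℕ i) then n else 0)
              (trans (count-spendFix (toℕ i ≡ᵇ j) (λ f′ → good (suc j) (toℕ i) e f′) f (allVecs m N))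
                     (spendFix-cong 0 (toℕ i ≡ᵇ j) (λ f′ → count-good m (suc j) (toℕ i) e f′ e<N) f)) ⟩
        (if step a (toℕ i) then G (toℕ i) else 0)
      ∎

  count-startsAt : ∀ m c e f → e < N →
                   count (startsAt c e f) (allVecs (suc m) N) ≡ spendFix 0 (c ≡ᵇ 0) (chains m 1 c e) f
  count-startsAt m c e f e<N =
    begin
      count (startsAt c e f) (concatMap (λ x → map (x ∷_) (allVecs m N)) (tabulate (λ x → x)))
    ≡⟨ count-concatMap N (startsAt c e f) (λ x → map (x ∷_) (allVecs m N)) (λ x → x) ⟩
      sumFin N (λ i → count (startsAt c e f) (map (i ∷_) (allVecs m N)))
    ≡⟨ sumFin-cong N summand ⟩
      sumFin N (λ i → if toℕ i ≡ᵇ c then G (toℕ i) else 0)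
    ≡⟨ select-one N c G (λ t N≤t → spendFix-zero (t ≡ᵇ 0)
                                     (λ f′ → chains-overshoot m 1 t e f′ (<-≤-trans e<N N≤t)) f) ⟩
      G c
    ∎
    where
    open ≡-Reasoning
    G : ℕ → ℕ
    G t = spendFix 0 (t ≡ᵇ 0) (chains m 1 t e) f
    summand : ∀ i → count (startsAt c e f) (map (i ∷_) (allVecs m N)) ≡ (if toℕ i ≡ᵇ c then G (toℕ i) else 0)
    summand i =
      begin
        count (startsAt c e f) (map (i ∷_) (allVecs m N))
      ≡⟨ count-map (startsAt c e f) (i ∷_) (allVecs m N) ⟩
        count (λ w → (toℕ i ≡ᵇ c) ∧ spendFix false (toℕ i ≡ᵇ 0) (λ f′ → good 1 (toℕ i) e f′ w) f) (allVecs m N)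
      ≡⟨ count-∧ (toℕ i ≡ᵇ c) _ (allVecs m N) ⟩
        (if toℕ i ≡ᵇ c
         then count (λ w → spendFix false (toℕ i ≡ᵇ 0) (λ f′ → good 1 (toℕ i) e f′ w) f) (allVecs m N)
         else 0)
      ≡⟨ cong (λ n → if toℕ i ≡ᵇ c then n else 0)
              (trans (count-spendFix (toℕ i ≡ᵇ 0) (λ f′ → good 1 (toℕ i) e f′) f (allVecs m N))
                     (spendFix-cong 0 (toℕ i ≡ᵇ 0) (λ f′ → count-good m 1 (toℕ i) e f′ e<N) f)) ⟩
        (if toℕ i ≡ᵇ c then G (toℕ i) else 0)
      ∎

∧-split : ∀ {b c} → T (b ∧ c) → T b × T c
∧-split = Equivalence.to T-∧

∧-join : ∀ {b c} → T b → T c → T (b ∧ c)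
∧-join tb tc = Equivalence.from T-∧ (tb , tc)

step-bounds : ∀ a t → T (step a t) → a ≤ t × t ≤ suc a
step-bounds a t st with Equivalence.to (T-∨ {t ≡ᵇ a}) st
... | inj₁ t≡a   = let eq = ≡ᵇ⇒≡ t a t≡a in ≤-reflexive (sym eq) , ≤-trans (≤-reflexive eq) (n≤1+n a)
... | inj₂ t≡a+1 = let eq = ≡ᵇ⇒≡ t (suc a) t≡a+1 in ≤-trans (n≤1+n a) (≤-reflexive (sym eq)) , ≤-reflexive eq

bounds-step : ∀ a t → a ≤ t → t ≤ suc a → T (step a t)
bounds-step a t a≤t t≤a+1 with m≤n⇒m<n∨m≡n t≤a+1
... | inj₁ t<a+1 = Equivalence.from T-∨ (inj₁ (≡⇒≡ᵇ t a (≤-antisym (s≤s⁻¹ t<a+1) a≤t)))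
... | inj₂ t≡a+1 = Equivalence.from (T-∨ {t ≡ᵇ a}) (inj₂ (≡⇒≡ᵇ t (suc a) t≡a+1))

module _ {N : ℕ} where

  OrderPreservingVec : ∀ {m} → Vec (Fin N) m → Set
  OrderPreservingVec {m} v = (x y : Fin m) → toℕ x ≤ toℕ y → toℕ (lookup v x) ≤ toℕ (lookup v y)

  ContractionVec : ∀ {m} → Vec (Fin N) m → Set
  ContractionVec {m} v = (x y : Fin m) → ∣ toℕ (lookup v x) - toℕ (lookup v y) ∣ ≤ ∣ toℕ x - toℕ y ∣

  start≤last : ∀ {m} a (w : Vec (Fin N) m) → T (chainFrom a w) → a ≤ lastFrom a w
  start≤last a []      _  = ≤-refl
  start≤last a (y ∷ w) ch =
    ≤-trans (proj₁ (step-bounds a (toℕ y) (proj₁ (∧-split ch)))) (start≤last (toℕ y) w (proj₂ (∧-split ch)))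

  chain-lower : ∀ {m} a (w : Vec (Fin N) m) → T (chainFrom a w) → ∀ i → a ≤ toℕ (lookup w i)
  chain-lower a (y ∷ w) ch zero    = proj₁ (step-bounds a (toℕ y) (proj₁ (∧-split ch)))
  chain-lower a (y ∷ w) ch (suc i) =
    ≤-trans (proj₁ (step-bounds a (toℕ y) (proj₁ (∧-split ch)))) (chain-lower (toℕ y) w (proj₂ (∧-split ch)) i)

  chain-upper : ∀ {m} a (w : Vec (Fin N) m) → T (chainFrom a w) → ∀ i → toℕ (lookup w i) ≤ lastFrom a w
  chain-upper a (y ∷ w) ch zero    = start≤last (toℕ y) w (proj₂ (∧-split ch))
  chain-upper a (y ∷ w) ch (suc i) = chain-upper (toℕ y) w (proj₂ (∧-split ch)) i

  chain-slow : ∀ {m} a (w : Vec (Fin N) m) → T (chainFrom a w) → ∀ i → toℕ (lookup w i) ≤ a + suc (toℕ i)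
  chain-slow a (y ∷ w) ch zero    =
    ≤-trans (proj₂ (step-bounds a (toℕ y) (proj₁ (∧-split ch)))) (≤-reflexive (+-comm 1 a))
  chain-slow a (y ∷ w) ch (suc i) =
    ≤-trans (chain-slow (toℕ y) w (proj₂ (∧-split ch)) i)
      (≤-trans (+-monoˡ-≤ (suc (toℕ i)) (proj₂ (step-bounds a (toℕ y) (proj₁ (∧-split ch)))))
               (≤-reflexive (sym (+-suc a (suc (toℕ i))))))

  entry-lower : ∀ {m} x (w : Vec (Fin N) m) → T (chainFrom (toℕ x) w) → ∀ i → toℕ x ≤ toℕ (lookup (x ∷ w) i)
  entry-lower x w ch zero    = ≤-refl
  entry-lower x w ch (suc i) = chain-lower (toℕ x) w ch i

  entry-upper : ∀ {m} x (w : Vec (Fin N) m) → T (chainFrom (toℕ x) w) →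
                ∀ i → toℕ (lookup (x ∷ w) i) ≤ lastFrom (toℕ x) w
  entry-upper x w ch zero    = start≤last (toℕ x) w ch
  entry-upper x w ch (suc i) = chain-upper (toℕ x) w ch i

  last-attained : ∀ {m} x (w : Vec (Fin N) m) → ∃ λ i → toℕ (lookup (x ∷ w) i) ≡ lastFrom (toℕ x) w
  last-attained x []      = zero , refl
  last-attained x (y ∷ w) with last-attained y w
  ... | i , eq = suc i , eq

  intermediate-value : ∀ {m} x (w : Vec (Fin N) m) → T (chainFrom (toℕ x) w) →
                       ∀ t → toℕ x ≤ t → t ≤ lastFrom (toℕ x) w → ∃ λ i → toℕ (lookup (x ∷ w) i) ≡ t
  intermediate-value x []      _  t x≤t t≤L = zero , ≤-antisym x≤t t≤L
  intermediate-value x (y ∷ w) ch t x≤t t≤L with toℕ x ≟ t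
  ... | yes x≡t = zero , x≡t
  ... | no  x≢t with intermediate-value y w (proj₂ (∧-split ch)) t
                       (≤-trans (proj₂ (step-bounds (toℕ x) (toℕ y) (proj₁ (∧-split ch)))) (≤∧≢⇒< x≤t x≢t)) t≤L
  ...   | i , eq = suc i , eq

  chain⇒orderPreserving : ∀ {m} x (w : Vec (Fin N) m) → T (chainFrom (toℕ x) w) → OrderPreservingVec (x ∷ w)
  chain⇒orderPreserving x w       ch zero    zero    _       = ≤-refl
  chain⇒orderPreserving x w       ch zero    (suc j) _       = chain-lower (toℕ x) w ch j
  chain⇒orderPreserving x (y ∷ w) ch (suc i) (suc j) (s≤s h) = chain⇒orderPreserving y w (proj₂ (∧-split ch)) i j h

  from-start : ∀ {m} a (w : Vec (Fin N) m) → T (chainFrom a w) → ∀ j → ∣ a - toℕ (lookup w j) ∣ ≤ suc (toℕ j)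
  from-start a w ch j =
    subst (_≤ suc (toℕ j)) (sym (m≤n⇒∣m-n∣≡n∸m (chain-lower a w ch j))) (m≤n+o⇒m∸n≤o _ a (chain-slow a w ch j))

  chain⇒contraction : ∀ {m} x (w : Vec (Fin N) m) → T (chainFrom (toℕ x) w) → ContractionVec (x ∷ w)
  chain⇒contraction x w       ch zero    zero    = ≤-reflexive (∣n-n∣≡0 (toℕ x))
  chain⇒contraction x w       ch zero    (suc j) = from-start (toℕ x) w ch j
  chain⇒contraction x w       ch (suc i) zero    =
    subst (_≤ suc (toℕ i)) (∣-∣-comm (toℕ x) _) (from-start (toℕ x) w ch i)
  chain⇒contraction x (y ∷ w) ch (suc i) (suc j) = chain⇒contraction y w (proj₂ (∧-split ch)) i j

  oct⇒chain : ∀ {m} x (w : Vec (Fin N) m) → OrderPreservingVec (x ∷ w) → ContractionVec (x ∷ w) →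
              T (chainFrom (toℕ x) w)
  oct⇒chain x []      op ct = tt
  oct⇒chain x (y ∷ w) op ct =
    ∧-join (bounds-step (toℕ x) (toℕ y) x≤y y≤x+1)
           (oct⇒chain y w (λ i j h → op (suc i) (suc j) (s≤s h)) (λ i j → ct (suc i) (suc j)))
    where
    x≤y : toℕ x ≤ toℕ y
    x≤y = op zero (suc zero) z≤n
    y∸x≤1 : toℕ y ∸ toℕ x ≤ 1
    y∸x≤1 = subst (_≤ 1) (m≤n⇒∣m-n∣≡n∸m x≤y) (ct zero (suc zero))
    y≤x+1 : toℕ y ≤ suc (toℕ x)
    y≤x+1 = ≤-trans (≤-reflexive (sym (m+[n∸m]≡n x≤y)))
                    (≤-trans (+-monoʳ-≤ (toℕ x) y∸x≤1) (≤-reflexive (+-comm (toℕ x) 1)))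

module _ {n′ : ℕ} (x : Fin (suc n′)) (w : Vec (Fin (suc n′)) n′) (ch : T (chainFrom (toℕ x) w)) where

  private
    N = suc n′
    a = toℕ x
    L = lastFrom a w

  inInterval : Fin N → Bool
  inInterval y = (a <ᵇ suc (toℕ y)) ∧ (toℕ y <ᵇ suc L)

  image⇔interval : ∀ y → (∃ λ z → z · (x ∷ w) ≡ y) ⇔ T (inInterval y)
  image⇔interval y = mk⇔ to from
    where
    to : (∃ λ z → z · (x ∷ w) ≡ y) → T (inInterval y)
    to (z , refl) = ∧-join (<⇒<ᵇ (s≤s (entry-lower x w ch z))) (<⇒<ᵇ (s≤s (entry-upper x w ch z)))
    from : T (inInterval y) → ∃ λ z → z · (x ∷ w) ≡ y
    from t with intermediate-value x w ch (toℕ y) (s≤s⁻¹ (<ᵇ⇒< _ _ (proj₁ (∧-split t))))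
                                                  (s≤s⁻¹ (<ᵇ⇒< _ _ (proj₂ (∧-split {a <ᵇ suc (toℕ y)} t))))
    ... | i , eq = i , toℕ-injective eq

  height-chain : height (x ∷ w) ≡ suc L ∸ a
  height-chain =
    begin
      length (filter (λ y → any? (λ z → (z · (x ∷ w)) Fin.≟ y)) (allFin N))
    ≡⟨ length-filter (λ y → any? (λ z → (z · (x ∷ w)) Fin.≟ y)) (allFin N) ⟩
      count (λ y → does (any? (λ z → (z · (x ∷ w)) Fin.≟ y))) (allFin N)
    ≡⟨ count-cong (λ y → does-⇔ (image⇔interval y) (any? (λ z → (z · (x ∷ w)) Fin.≟ y)) (T? _)) (allFin N) ⟩
      count inInterval (allFin N)
    ≡⟨ count-tabulate N inInterval (λ y → y) ⟩
      sumFin N (λ i → indicator (inInterval i))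
    ≡⟨ interval N a L (start≤last a w ch) (subst (_< N) (proj₂ (last-attained x w)) (toℕ<n _)) ⟩
      suc L ∸ a
    ∎
    where open ≡-Reasoning

  waist-chain : ∀ k → RightWaistIs (x ∷ w) k ⇔ suc L ≡ k
  waist-chain k = mk⇔ to from
    where
    top = last-attained x w
    to : RightWaistIs (x ∷ w) k → suc L ≡ k
    to ((i , eq) , below) =
      ≤-antisym (subst (λ t → suc t ≤ k) (proj₂ top) (below (proj₁ top)))
                (subst (_≤ suc L) eq (s≤s (entry-upper x w ch i)))
    from : suc L ≡ k → RightWaistIs (x ∷ w) k
    from eq = (proj₁ top , trans (cong suc (proj₂ top)) eq) ,
              (λ i → subst (suc (toℕ (lookup (x ∷ w) i)) ≤_) eq (s≤s (entry-upper x w ch i)))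

module _ {N : ℕ} where

  fixes-sum : ∀ {m} (w : Vec (Fin N) m) s →
              sumFin m (λ i → indicator (toℕ (lookup w i) ≡ᵇ s + toℕ i)) ≡ fixesFrom s w
  fixes-sum []      s = refl
  fixes-sum (y ∷ w) s =
    cong₂ _+_ (cong (λ k → indicator (toℕ y ≡ᵇ k)) (+-identityʳ s))
              (trans (sumFin-cong _ (λ i → cong (λ k → indicator (toℕ (lookup w i) ≡ᵇ k)) (+-suc s (toℕ i))))
                     (fixes-sum w (suc s)))

  fix-fixesFrom : (α : Transformation N) → fix α ≡ fixesFrom 0 α
  fix-fixesFrom α =
    begin
      length (filter (λ x → (x · α) Fin.≟ x) (allFin N))
    ≡⟨ length-filter (λ x → (x · α) Fin.≟ x) (allFin N) ⟩
      count (λ x → does ((x · α) Fin.≟ x)) (allFin N)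
    ≡⟨ count-cong (λ x → does-⇔ toℕ-eq ((x · α) Fin.≟ x) (T? _)) (allFin N) ⟩
      count (λ x → toℕ (lookup α x) ≡ᵇ toℕ x) (allFin N)
    ≡⟨ count-tabulate N (λ x → toℕ (lookup α x) ≡ᵇ toℕ x) (λ x → x) ⟩
      sumFin N (λ i → indicator (toℕ (lookup α i) ≡ᵇ 0 + toℕ i))
    ≡⟨ fixes-sum α 0 ⟩
      fixesFrom 0 α
    ∎
    where
    open ≡-Reasoning
    toℕ-eq : ∀ {u v : Fin N} → (u ≡ v) ⇔ T (toℕ u ≡ᵇ toℕ v)
    toℕ-eq = mk⇔ (λ u≡v → ≡⇒≡ᵇ _ _ (cong toℕ u≡v)) (λ t → toℕ-injective (≡ᵇ⇒≡ _ _ t))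

startsAt⇔ : ∀ {N m} c e f (x : Fin N) (w : Vec (Fin N) m) →
            T (startsAt c e f (x ∷ w))
              ⇔ (toℕ x ≡ c × T (chainFrom (toℕ x) w) × lastFrom (toℕ x) w ≡ e × f ≡ fixesFrom 0 (x ∷ w))
startsAt⇔ c e f x w = mk⇔ to from
  where
  to : T (startsAt c e f (x ∷ w)) →
       toℕ x ≡ c × T (chainFrom (toℕ x) w) × lastFrom (toℕ x) w ≡ e × f ≡ fixesFrom 0 (x ∷ w)
  to t with ∧-split (subst T (startsAt-spec c e f x w) t)
  ... | x≡c , t′ with ∧-split t′
  ...   | ch , t″ with ∧-split {lastFrom (toℕ x) w ≡ᵇ e} t″
  ...     | L≡e , f≡fixes = ≡ᵇ⇒≡ _ _ x≡c , ch , ≡ᵇ⇒≡ _ _ L≡e , ≡ᵇ⇒≡ _ _ f≡fixes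
  from : toℕ x ≡ c × T (chainFrom (toℕ x) w) × lastFrom (toℕ x) w ≡ e × f ≡ fixesFrom 0 (x ∷ w) →
         T (startsAt c e f (x ∷ w))
  from (x≡c , ch , L≡e , f≡fixes) =
    subst T (sym (startsAt-spec c e f x w))
      (∧-join (≡⇒≡ᵇ _ _ x≡c) (∧-join ch (∧-join (≡⇒≡ᵇ _ _ L≡e) (≡⇒≡ᵇ _ _ f≡fixes))))

∸-solve : ∀ {a p c} → a ≤ p + c → p + c ∸ a ≡ p → a ≡ c
∸-solve {a} {p} {c} a≤p+c diff = +-cancelˡ-≡ p a c (trans (cong (_+ a) (sym diff)) (m∸n+n≡m a≤p+c))

counted⇔startsAt : ∀ {n′ p m k′ c} (x : Fin (suc n′)) (w : Vec (Fin (suc n′)) n′) → suc k′ ≡ p + c →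
                   Counted p m (suc k′) (x ∷ w) ⇔ T (startsAt c k′ m (x ∷ w))
counted⇔startsAt {p = p} {m} {k′} {c} x w k≡p+c = mk⇔ to from
  where
  to : Counted p m (suc k′) (x ∷ w) → T (startsAt c k′ m (x ∷ w))
  to ((op , ct) , h≡p , f≡m , waist) =
    Equivalence.from (startsAt⇔ c k′ m x w) (x≡c , ch , L≡k′ , trans (sym f≡m) (fix-fixesFrom (x ∷ w)))
    where
    ch = oct⇒chain x w op ct
    L≡k′ = suc-injective (Equivalence.to (waist-chain x w ch (suc k′)) waist)
    x≤k+1 : toℕ x ≤ p + c
    x≤k+1 = ≤-trans (start≤last (toℕ x) w ch) (≤-trans (≤-reflexive L≡k′) (≤-trans (n≤1+n k′) (≤-reflexive k≡p+c)))
    x≡c : toℕ x ≡ c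
    x≡c = ∸-solve x≤k+1 (trans (cong (_∸ toℕ x) (trans (sym k≡p+c) (cong suc (sym L≡k′))))
                               (trans (sym (height-chain x w ch)) h≡p))
  from : T (startsAt c k′ m (x ∷ w)) → Counted p m (suc k′) (x ∷ w)
  from t with Equivalence.to (startsAt⇔ c k′ m x w) t
  ... | x≡c , ch , L≡k′ , m≡fixes =
    (chain⇒orderPreserving x w ch , chain⇒contraction x w ch) ,
    trans (height-chain x w ch) (trans (cong₂ (λ l a → suc l ∸ a) L≡k′ x≡c)
                                       (trans (cong (_∸ c) k≡p+c) (m+n∸n≡m p c))) ,
    trans (fix-fixesFrom (x ∷ w)) (sym m≡fixes) ,
    Equivalence.from (waist-chain x w ch (suc k′)) (cong suc L≡k′)

count-F : ∀ {n′ k′ p m} c → suc k′ ≡ p + c → k′ < suc n′ →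
          F (suc n′) p m (suc k′) ≡ spendFix 0 (c ≡ᵇ 0) (chains n′ 1 c k′) m
count-F {n′} {k′} {p} {m} c k≡p+c k′<N =
  begin
    length (filter (counted? p m (suc k′)) (allVecs (suc n′) (suc n′)))
  ≡⟨ length-filter (counted? p m (suc k′)) (allVecs (suc n′) (suc n′)) ⟩
    count (λ α → does (counted? p m (suc k′) α)) (allVecs (suc n′) (suc n′))
  ≡⟨ count-cong (λ { (x ∷ w) → does-⇔ (counted⇔startsAt x w k≡p+c) (counted? p m (suc k′) (x ∷ w)) (T? _) })
                (allVecs (suc n′) (suc n′)) ⟩
    count (startsAt c k′ m) (allVecs (suc n′) (suc n′))
  ≡⟨ count-startsAt n′ c k′ m k′<N ⟩
    spendFix 0 (c ≡ᵇ 0) (chains n′ 1 c k′) m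
  ∎
  where open ≡-Reasoning

int-difference : ∀ a b {n} → n ≡ a + b → + n - + a ≡ + b
int-difference a b refl = trans (ℤ.m-n≡m⊖n (a + b) a) (trans (ℤ.⊖-≥ (m≤m+n a b)) (cong +_ (m+n∸m≡n a b)))

-- The right-hand side of the theorem, with m = f + 1, p = m + u, k = p + c, n = k + r.
paper-binomial : ∀ f u c r →
  binomℤ (+ (suc f + u + c + r) - + suc f - + 1) (+ (suc f + u + c + r) - + (suc f + u) - + 1)
    ≡ shiftedBinom (u + (c + r)) (c + r)
paper-binomial f u c r =
  trans (cong₂ (λ s t → binomℤ (s - + 1) (t - + 1))
               (int-difference (suc f) (u + (c + r)) (trans (+-assoc (suc f + u) c r) (+-assoc (suc f) u (c + r))))
               (int-difference (suc f + u) (c + r) (+-assoc (suc f + u) c r)))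
        (binomℤ-shifted (u + (c + r)) (c + r))

proposition2p3 : (n p m k : ℕ) → 1 ≤ n → 1 ≤ m → m ≤ p → p ≤ k → k ≤ n →
    F n p m k ≡ binomℤ (+ n - + m - + 1) (+ n - + p - + 1)
proposition2p3 n p (suc f) k _ (s≤s z≤n) m≤p p≤k k≤n
  with u , refl ← m≤n⇒∃[o]m+o≡n m≤p
  with c , refl ← m≤n⇒∃[o]m+o≡n p≤k
  with r , refl ← m≤n⇒∃[o]m+o≡n k≤n =
  begin
    F (suc f + u + c + r) (suc f + u) (suc f) (suc f + u + c)
  ≡⟨ count-F c refl (s≤s (m≤m+n (f + u + c) r)) ⟩
    spendFix 0 (c ≡ᵇ 0) (chains (f + u + c + r) 1 c (f + u + c)) (suc f)
  ≡⟨ chains-count f u c r ⟩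
    shiftedBinom (u + (c + r)) (c + r)
  ≡⟨ paper-binomial f u c r ⟨
    binomℤ (+ (suc f + u + c + r) - + suc f - + 1) (+ (suc f + u + c + r) - + (suc f + u) - + 1)
  ∎
  where open ≡-Reasoning
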